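{- Let $m,n\in\mathbb{N}$. A graph morphism $f:C_m\to C_n$ preserves both binary meets and binary joins if and only if it is dimension-preserving.
   Context: A graph is a pair $(V,E)$ with $E\subseteq V\times V$; a graph morphism $(V,E)\to(V',E')$ is a function $f:V\to V'$ such that $(s,t)\in E$ implies $(f(s),f(t))\in E'$; it sends an edge $(s,t)$ to the edge $(f(s),f(t))$. The standard $n$-cube graph $C_n$ has vertex set $\{0,1\}^n$ and edges: a loop $(v,v)$ at every vertex, and an edge $(u,v)$ whenever $u,v$ differ in exactly one coordinate $i$ with $u_i=0$, $v_i=1$. The preorder $C_n^*$ ($u\le v$ iff a directed chain of edges leads from $u$ to $v$) is the coordinatewise order; binary meets $u\wedge v$ and joins $u\vee v$ are coordinatewise min and max. $f$ preserves meets (joins) if $f(u\wedge v)=f(u)\wedge f(v)$ ($f(u\vee v)=f(u)\vee f(v)$) for all $u,v$. The dimension of an edge of $C_n$ is the special value "trivial" for a loop, and $i\in[n]=\{0,\dots,n-1\}$ for a non-loop edge between vertices differing in coordinate $i$. A graph morphism $f:C_m\to C_n$ is dimension-preserving if for any two edges $e_1,e_2$ of $C_m$ of equal dimension, the edges $f(e_1),f(e_2)$ of $C_n$ have equal dimension. -}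

module Defs where

open import Data.Nat using (ℕ)
open import Data.Bool using (Bool; true; false; _∧_; _∨_)
open import Data.Fin using (Fin)
open import Data.Vec using (Vec; lookup; zipWith)
open import Data.Maybe using (Maybe; just; nothing)
open import Data.Product using (Σ; _×_; _,_)
open import Data.Sum using (_⊎_; inj₁; inj₂)
open import Relation.Binary.PropositionalEquality using (_≡_; _≢_)

-- Vertices of the standard n-cube C_n : elements of {0,1}^n (false = 0, true = 1).
Vertex : ℕ → Set
Vertex n = Vec Bool n

StepAt : {n : ℕ} → Fin n → Vertex n → Vertex n → Set
StepAt i u v = (lookup u i ≡ false) × (lookup v i ≡ true)
             × (∀ j → j ≢ i → lookup u j ≡ lookup v j)

Edge : (n : ℕ) → Vertex n → Vertex n → Set
Edge n u v = (u ≡ v) ⊎ Σ (Fin n) (λ i → StepAt i u v)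

-- Dimension of an edge: nothing = "trivial" (loop), just i = coordinate i.
dim : {n : ℕ} {u v : Vertex n} → Edge n u v → Maybe (Fin n)
dim (inj₁ _)       = nothing
dim (inj₂ (i , _)) = just i

record CubeMorphism (m n : ℕ) : Set where
  field
    fun      : Vertex m → Vertex n
    preserve : ∀ {u v} → Edge m u v → Edge n (fun u) (fun v)
open CubeMorphism public

_⊓_ : {n : ℕ} → Vertex n → Vertex n → Vertex n
u ⊓ v = zipWith _∧_ u v

_⊔_ : {n : ℕ} → Vertex n → Vertex n → Vertex n
u ⊔ v = zipWith _∨_ u v

PreservesMeets : {m n : ℕ} → (Vertex m → Vertex n) → Set
PreservesMeets f = ∀ u v → f (u ⊓ v) ≡ f u ⊓ f v

PreservesJoins : {m n : ℕ} → (Vertex m → Vertex n) → Set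
PreservesJoins f = ∀ u v → f (u ⊔ v) ≡ f u ⊔ f v

-- The image of an edge e : u → v under f is the edge (f u, f v), witnessed by
-- 'preserve f e'. Dimension-preserving: edges of equal dimension go to edges
-- of equal dimension.
DimensionPreserving : {m n : ℕ} → CubeMorphism m n → Set
DimensionPreserving {m} {n} f =
  ∀ {u₁ v₁ u₂ v₂ : Vertex m} (e₁ : Edge m u₁ v₁) (e₂ : Edge m u₂ v₂) →
    dim e₁ ≡ dim e₂ → dim (preserve f e₁) ≡ dim (preserve f e₂)

-- Every i-edge u → v is the side opposite 0 → eᵢ in the square u ⊓ eᵢ = 0,
-- u ⊔ eᵢ = v. A lattice morphism f keeps this a square, and in a cube square
-- opposite sides have the same dimension, so f sends every i-edge to an edge of
-- the dimension δ i of f(0 → eᵢ). Conversely, if f sends all i-edges to edges of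
-- dimension δ i, induct on m splitting on the first coordinate: f either ignores
-- it (δ 0 trivial) or it only switches coordinate j of the image (δ 0 = j), and
-- in both cases meets and joins are preserved.
module Submission where

open import Defs
open import Data.Nat using (ℕ; zero; suc)
open import Data.Bool using (Bool; true; false; _∧_; _∨_)
open import Data.Bool.Properties
  using (∧-comm; ∨-comm; ∧-idem; ∨-idem; ∧-identityʳ; ∧-zeroʳ; ∨-zeroʳ; ∨-identityʳ)
open import Data.Fin using (Fin; zero; suc; _≟_)
open import Data.Vec using ([]; _∷_; lookup; zipWith; replicate; _[_]≔_)
open import Data.Vec.Properties
  using (lookup-zipWith; lookup-replicate; lookup∘update; lookup∘update′;
         tabulate∘lookup; tabulate-cong; zipWith-comm; zipWith-idem)
open import Data.Maybe using (Maybe; just; nothing; _>>=_)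
open import Data.Product using (_×_; _,_; proj₁)
open import Data.Sum using (inj₁; inj₂)
open import Data.Empty using (⊥-elim)
open import Function using (_∘_)
open import Function.Bundles using (_⇔_; mk⇔)
open import Relation.Nullary using (¬_; yes; no)
open import Relation.Binary.PropositionalEquality
open import Algebra.Definitions {A = Bool} _≡_ using (Commutative; Idempotent)
open ≡-Reasoning

private
  variable
    m n : ℕ
    i j : Fin n
    a b c u v : Vertex n

lookup-ext : (∀ k → lookup a k ≡ lookup b k) → a ≡ b
lookup-ext {a = a} {b = b} a≗b =
  trans (sym (tabulate∘lookup a)) (trans (tabulate-cong a≗b) (tabulate∘lookup b))

lookup-ext-at : (j : Fin n) → lookup a j ≡ lookup b j →
                (∀ k → k ≢ j → lookup a k ≡ lookup b k) → a ≡ b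
lookup-ext-at {a = a} {b = b} j at-j off-j = lookup-ext coordinate
  where
  coordinate : ∀ k → lookup a k ≡ lookup b k
  coordinate k with k ≟ j
  ... | yes refl = at-j
  ... | no k≢j   = off-j k k≢j

lookup-⊓ : (a b : Vertex n) (k : Fin n) → lookup (a ⊓ b) k ≡ lookup a k ∧ lookup b k
lookup-⊓ a b k = lookup-zipWith _∧_ k a b

lookup-⊔ : (a b : Vertex n) (k : Fin n) → lookup (a ⊔ b) k ≡ lookup a k ∨ lookup b k
lookup-⊔ a b k = lookup-zipWith _∨_ k a b

∧-absorbsʳ⇒∨-absorbsʳ : ∀ p q → p ∧ q ≡ q → p ∨ q ≡ p
∧-absorbsʳ⇒∨-absorbsʳ false q q≡false = sym q≡false
∧-absorbsʳ⇒∨-absorbsʳ true  q _       = refl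

step-irreflexive : ¬ StepAt j a a
step-irreflexive (aⱼ≡false , aⱼ≡true , _) with () ← trans (sym aⱼ≡false) aⱼ≡true

step-coordinate-unique : StepAt i a b → StepAt j a b → i ≡ j
step-coordinate-unique {i = i} {j = j} (aᵢ≡false , bᵢ≡true , _) (_ , _ , off-j) with i ≟ j
... | yes i≡j = i≡j
... | no  i≢j with () ← trans (sym aᵢ≡false) (trans (off-j i i≢j) bᵢ≡true)

step-target-unique : (a : Vertex n) → StepAt j a b → StepAt j a c → b ≡ c
step-target-unique {j = j} _ (_ , bⱼ≡true , off-b) (_ , cⱼ≡true , off-c) =
  lookup-ext-at j (trans bⱼ≡true (sym cⱼ≡true))
    (λ k k≢j → trans (sym (off-b k k≢j)) (off-c k k≢j))

EdgeOfDim : Maybe (Fin n) → Vertex n → Vertex n → Set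
EdgeOfDim nothing  u v = u ≡ v
EdgeOfDim (just i) u v = StepAt i u v

edge-edgeOfDim : (e : Edge n u v) → EdgeOfDim (dim e) u v
edge-edgeOfDim (inj₁ u≡v)     = u≡v
edge-edgeOfDim (inj₂ (_ , s)) = s

dim-unique : (d : Maybe (Fin n)) → EdgeOfDim d u v → (e : Edge n u v) → dim e ≡ d
dim-unique             nothing  _    (inj₁ _)        = refl
dim-unique {u = u}     nothing  refl (inj₂ (i , s))  = ⊥-elim (step-irreflexive {j = i} {a = u} s)
dim-unique {u = u}     (just i) s    (inj₁ refl)     = ⊥-elim (step-irreflexive {j = i} {a = u} s)
dim-unique {u = u} {v} (just _) s    (inj₂ (_ , s′)) =
  cong just (step-coordinate-unique {a = u} {b = v} s′ s)

opposite-edgeOfDim : (d : Maybe (Fin n)) {a b c e : Vertex n} →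
                     c ≡ a ⊓ b → e ≡ a ⊔ b → EdgeOfDim d c b → EdgeOfDim d a e
opposite-edgeOfDim d {a} {b} {c} {e} c≡a⊓b e≡a⊔b = transport d
  where
  agree : ∀ k → lookup c k ≡ lookup b k → lookup a k ≡ lookup e k
  agree k cₖ≡bₖ = sym (begin
    lookup e k                ≡⟨ cong (λ w → lookup w k) e≡a⊔b ⟩
    lookup (a ⊔ b) k          ≡⟨ lookup-⊔ a b k ⟩
    lookup a k ∨ lookup b k   ≡⟨ ∧-absorbsʳ⇒∨-absorbsʳ (lookup a k) (lookup b k) a∧b≡b ⟩
    lookup a k                ∎)
    where
    a∧b≡b : lookup a k ∧ lookup b k ≡ lookup b k
    a∧b≡b = trans (sym (lookup-⊓ a b k))
                  (trans (cong (λ w → lookup w k) (sym c≡a⊓b)) cₖ≡bₖ)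

  transport : (d : Maybe (Fin _)) → EdgeOfDim d c b → EdgeOfDim d a e
  transport nothing  c≡b = lookup-ext λ k → agree k (cong (λ w → lookup w k) c≡b)
  transport (just j) (cⱼ≡false , bⱼ≡true , off-j) =
    aⱼ≡false , eⱼ≡true , λ k k≢j → agree k (off-j k k≢j)
    where
    aⱼ≡false : lookup a j ≡ false
    aⱼ≡false = begin
      lookup a j                 ≡⟨ sym (∧-identityʳ (lookup a j)) ⟩
      lookup a j ∧ true          ≡⟨ cong (lookup a j ∧_) (sym bⱼ≡true) ⟩
      lookup a j ∧ lookup b j    ≡⟨ sym (lookup-⊓ a b j) ⟩
      lookup (a ⊓ b) j           ≡⟨ cong (λ w → lookup w j) (sym c≡a⊓b) ⟩
      lookup c j                 ≡⟨ cⱼ≡false ⟩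
      false                      ∎
    eⱼ≡true : lookup e j ≡ true
    eⱼ≡true = begin
      lookup e j                 ≡⟨ cong (λ w → lookup w j) e≡a⊔b ⟩
      lookup (a ⊔ b) j           ≡⟨ lookup-⊔ a b j ⟩
      lookup a j ∨ lookup b j    ≡⟨ cong (lookup a j ∨_) bⱼ≡true ⟩
      lookup a j ∨ true          ≡⟨ ∨-zeroʳ (lookup a j) ⟩
      true                       ∎

origin : (n : ℕ) → Vertex n
origin n = replicate n false

basis : Fin n → Vertex n
basis i = origin _ [ i ]≔ true

lookup-basis-on : (i : Fin n) → lookup (basis i) i ≡ true
lookup-basis-on i = lookup∘update i (origin _) true

lookup-basis-off : ∀ {k} → k ≢ i → lookup (basis i) k ≡ false
lookup-basis-off {k = k} k≢i = trans (lookup∘update′ k≢i (origin _) true) (lookup-replicate k false)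

basis-step : (i : Fin n) → StepAt i (origin n) (basis i)
basis-step i = lookup-replicate i false , lookup-basis-on i ,
               λ k k≢i → trans (lookup-replicate k false) (sym (lookup-basis-off k≢i))

basis-edge : (i : Fin n) → Edge n (origin n) (basis i)
basis-edge i = inj₂ (i , basis-step i)

⊓-basis≡origin : (u : Vertex n) (i : Fin n) → lookup u i ≡ false → u ⊓ basis i ≡ origin n
⊓-basis≡origin u i uᵢ≡false = lookup-ext-at i
  (trans (lookup-⊓ u (basis i) i)
         (trans (cong (_∧ lookup (basis i) i) uᵢ≡false) (sym (lookup-replicate i false))))
  (λ k k≢i → trans (lookup-⊓ u (basis i) k)
         (trans (cong (lookup u k ∧_) (lookup-basis-off k≢i))
         (trans (∧-zeroʳ (lookup u k)) (sym (lookup-replicate k false)))))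

⊔-basis≡target : (u v : Vertex n) → StepAt i u v → u ⊔ basis i ≡ v
⊔-basis≡target {i = i} u v (_ , vᵢ≡true , off-i) = lookup-ext-at i
  (trans (lookup-⊔ u (basis i) i)
         (trans (cong (lookup u i ∨_) (lookup-basis-on i))
         (trans (∨-zeroʳ (lookup u i)) (sym vᵢ≡true))))
  (λ k k≢i → trans (lookup-⊔ u (basis i) k)
         (trans (cong (lookup u k ∨_) (lookup-basis-off k≢i))
         (trans (∨-identityʳ (lookup u k)) (off-i k k≢i))))

_SendsStepsVia_ : (Vertex m → Vertex n) → (Fin m → Maybe (Fin n)) → Set
g SendsStepsVia δ = ∀ {i u v} → StepAt i u v → EdgeOfDim (δ i) (g u) (g v)

basisDim : CubeMorphism m n → Fin m → Maybe (Fin n)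
basisDim f i = dim (preserve f (basis-edge i))

lattice⇒sendsSteps : (f : CubeMorphism m n) →
                     PreservesMeets (fun f) → PreservesJoins (fun f) →
                     fun f SendsStepsVia basisDim f
lattice⇒sendsSteps f meets joins {i} {u} {v} s =
  opposite-edgeOfDim (basisDim f i) f₀≡fu⊓fb fv≡fu⊔fb (edge-edgeOfDim (preserve f (basis-edge i)))
  where
  f₀≡fu⊓fb : fun f (origin _) ≡ fun f u ⊓ fun f (basis i)
  f₀≡fu⊓fb = trans (cong (fun f) (sym (⊓-basis≡origin u i (proj₁ s)))) (meets u (basis i))
  fv≡fu⊔fb : fun f v ≡ fun f u ⊔ fun f (basis i)
  fv≡fu⊔fb = trans (cong (fun f) (sym (⊔-basis≡target u v s))) (joins u (basis i))

dimensionPreserving⇒sendsSteps : (f : CubeMorphism m n) → DimensionPreserving f →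
                                 fun f SendsStepsVia basisDim f
dimensionPreserving⇒sendsSteps f preserving {i} {u} {v} s =
  subst (λ d → EdgeOfDim d (fun f u) (fun f v))
        (preserving (inj₂ (i , s)) (basis-edge i) refl)
        (edge-edgeOfDim (preserve f (inj₂ (i , s))))

sendsSteps⇒dimensionPreserving : (f : CubeMorphism m n) {δ : Fin m → Maybe (Fin n)} →
                                 fun f SendsStepsVia δ → DimensionPreserving f
sendsSteps⇒dimensionPreserving {m} f {δ} sends e₁ e₂ dim₁≡dim₂ =
  trans (image-dim e₁) (trans (cong (_>>= δ) dim₁≡dim₂) (sym (image-dim e₂)))
  where
  image-dim : (e : Edge m u v) → dim (preserve f e) ≡ (dim e >>= δ)
  image-dim (inj₁ refl)     = dim-unique nothing refl (preserve f (inj₁ refl))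
  image-dim (inj₂ (i , s))  = dim-unique (δ i) (sends s) (preserve f (inj₂ (i , s)))

Preserves₂ : (Bool → Bool → Bool) → (Vertex m → Vertex n) → Set
Preserves₂ _•_ g = ∀ u v → g (zipWith _•_ u v) ≡ zipWith _•_ (g u) (g v)

preserves₂-nullary : {_•_ : Bool → Bool → Bool} → Idempotent _•_ →
                     (g : Vertex 0 → Vertex n) → Preserves₂ _•_ g
preserves₂-nullary idem g [] [] = sym (zipWith-idem idem (g []))

preserves₂-flip : {_•_ : Bool → Bool → Bool} → Commutative _•_ →
                  {g : Vertex m → Vertex n} {u v : Vertex m} →
                  g (zipWith _•_ v u) ≡ zipWith _•_ (g v) (g u) →
                  g (zipWith _•_ u v) ≡ zipWith _•_ (g u) (g v)
preserves₂-flip comm {g} {u} {v} pres-vu = begin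
  g (zipWith _ u v)        ≡⟨ cong g (zipWith-comm comm u v) ⟩
  g (zipWith _ v u)        ≡⟨ pres-vu ⟩
  zipWith _ (g v) (g u)    ≡⟨ zipWith-comm comm (g v) (g u) ⟩
  zipWith _ (g u) (g v)    ∎

preserves₂-headless : {_•_ : Bool → Bool → Bool} {g : Vertex (suc m) → Vertex n} →
                      (∀ s → g (true ∷ s) ≡ g (false ∷ s)) →
                      Preserves₂ _•_ (g ∘ (false ∷_)) → Preserves₂ _•_ g
preserves₂-headless {_•_ = _•_} {g} true≈false pres (p ∷ s) (q ∷ t) = begin
  g ((p • q) ∷ zipWith _•_ s t)                  ≡⟨ ignore (p • q) _ ⟩
  g (false ∷ zipWith _•_ s t)                    ≡⟨ pres s t ⟩
  zipWith _•_ (g (false ∷ s)) (g (false ∷ t))    ≡⟨ sym (cong₂ (zipWith _•_) (ignore p s) (ignore q t)) ⟩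
  zipWith _•_ (g (p ∷ s)) (g (q ∷ t))            ∎
  where
  ignore : ∀ p s → g (p ∷ s) ≡ g (false ∷ s)
  ignore false s = refl
  ignore true  s = true≈false s

step-⊓ : (x x′ y : Vertex n) → StepAt j x x′ → lookup y j ≡ false → x′ ⊓ y ≡ x ⊓ y
step-⊓ {j = j} x x′ y (xⱼ≡false , _ , off-j) yⱼ≡false = lookup-ext-at j
  (begin
    lookup (x′ ⊓ y) j         ≡⟨ lookup-⊓ x′ y j ⟩
    lookup x′ j ∧ lookup y j  ≡⟨ cong (lookup x′ j ∧_) yⱼ≡false ⟩
    lookup x′ j ∧ false       ≡⟨ ∧-zeroʳ (lookup x′ j) ⟩
    false                     ≡⟨ sym (cong (_∧ lookup y j) xⱼ≡false) ⟩
    lookup x j ∧ lookup y j   ≡⟨ sym (lookup-⊓ x y j) ⟩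
    lookup (x ⊓ y) j          ∎)
  (λ k k≢j → trans (lookup-⊓ x′ y k)
    (trans (cong (_∧ lookup y k) (sym (off-j k k≢j))) (sym (lookup-⊓ x y k))))

step-⊔ : (x x′ y : Vertex n) → StepAt j x x′ → lookup y j ≡ false → StepAt j (x ⊔ y) (x′ ⊔ y)
step-⊔ {j = j} x x′ y (xⱼ≡false , x′ⱼ≡true , off-j) yⱼ≡false =
  trans (lookup-⊔ x y j) (cong₂ _∨_ xⱼ≡false yⱼ≡false) ,
  trans (lookup-⊔ x′ y j) (cong (_∨ lookup y j) x′ⱼ≡true) ,
  λ k k≢j → trans (lookup-⊔ x y k)
    (trans (cong (_∨ lookup y k) (off-j k k≢j)) (sym (lookup-⊔ x′ y k)))

step-cons : (p : Bool) → StepAt i u v → StepAt (suc i) (p ∷ u) (p ∷ v)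
step-cons p (uᵢ≡false , vᵢ≡true , off-i) = uᵢ≡false , vᵢ≡true , off-suc-i
  where
  off-suc-i : ∀ k → k ≢ suc _ → lookup (p ∷ _) k ≡ lookup (p ∷ _) k
  off-suc-i zero    _     = refl
  off-suc-i (suc k) k≢sᵢ  = off-i k (k≢sᵢ ∘ cong suc)

step-head : (s : Vertex n) → StepAt zero (false ∷ s) (true ∷ s)
step-head s = refl , refl , off-zero
  where
  off-zero : ∀ k → k ≢ zero → lookup (false ∷ s) k ≡ lookup (true ∷ s) k
  off-zero zero    k≢0 = ⊥-elim (k≢0 refl)
  off-zero (suc k) _   = refl

sendsSteps-tail : (p : Bool) {g : Vertex (suc m) → Vertex n} {δ : Fin (suc m) → Maybe (Fin n)} →
                  g SendsStepsVia δ → (g ∘ (p ∷_)) SendsStepsVia (δ ∘ suc)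
sendsSteps-tail p sends s = sends (step-cons p s)

sendsSteps⇒preservesMeets : {g : Vertex m → Vertex n} {δ : Fin m → Maybe (Fin n)} →
                            g SendsStepsVia δ → PreservesMeets g
sendsSteps⇒preservesMeets {zero}  {g = g} _ = preserves₂-nullary ∧-idem g
sendsSteps⇒preservesMeets {suc m} {g = g} {δ} sends = byHead (δ zero) (λ s → sends (step-head s))
  where
  meets₀ : PreservesMeets (g ∘ (false ∷_))
  meets₀ = sendsSteps⇒preservesMeets (sendsSteps-tail false {g} {δ} sends)
  meets₁ : PreservesMeets (g ∘ (true ∷_))
  meets₁ = sendsSteps⇒preservesMeets (sendsSteps-tail true {g} {δ} sends)

  byHead : ∀ d → (∀ s → EdgeOfDim d (g (false ∷ s)) (g (true ∷ s))) → PreservesMeets g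
  byHead nothing  column = preserves₂-headless (sym ∘ column) meets₀
  byHead (just j) column = meets
    where
    mixed : ∀ s t → g (false ∷ s ⊓ t) ≡ g (true ∷ s) ⊓ g (false ∷ t)
    mixed s t = trans (meets₀ s t)
      (sym (step-⊓ (g (false ∷ s)) (g (true ∷ s)) (g (false ∷ t)) (column s) (proj₁ (column t))))
    meets : PreservesMeets g
    meets (false ∷ s) (false ∷ t) = meets₀ s t
    meets (true  ∷ s) (true  ∷ t) = meets₁ s t
    meets (true  ∷ s) (false ∷ t) = mixed s t
    meets (false ∷ s) (true  ∷ t) = preserves₂-flip ∧-comm {g} (mixed t s)

sendsSteps⇒preservesJoins : {g : Vertex m → Vertex n} {δ : Fin m → Maybe (Fin n)} →
                            g SendsStepsVia δ → PreservesJoins g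
sendsSteps⇒preservesJoins {zero}  {g = g} _ = preserves₂-nullary ∨-idem g
sendsSteps⇒preservesJoins {suc m} {g = g} {δ} sends = byHead (δ zero) (λ s → sends (step-head s))
  where
  joins₀ : PreservesJoins (g ∘ (false ∷_))
  joins₀ = sendsSteps⇒preservesJoins (sendsSteps-tail false {g} {δ} sends)
  joins₁ : PreservesJoins (g ∘ (true ∷_))
  joins₁ = sendsSteps⇒preservesJoins (sendsSteps-tail true {g} {δ} sends)

  byHead : ∀ d → (∀ s → EdgeOfDim d (g (false ∷ s)) (g (true ∷ s))) → PreservesJoins g
  byHead nothing  column = preserves₂-headless (sym ∘ column) joins₀
  byHead (just j) column = joins
    where
    -- both sides are the target of the j-step out of g (false ∷ s ⊔ t)
    mixed : ∀ s t → g (true ∷ s ⊔ t) ≡ g (true ∷ s) ⊔ g (false ∷ t)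
    mixed s t = step-target-unique (g (false ∷ s) ⊔ g (false ∷ t))
                  (subst (λ w → StepAt j w (g (true ∷ s ⊔ t))) (joins₀ s t) (column (s ⊔ t)))
                  (step-⊔ (g (false ∷ s)) (g (true ∷ s)) (g (false ∷ t))
                          (column s) (proj₁ (column t)))
    joins : PreservesJoins g
    joins (false ∷ s) (false ∷ t) = joins₀ s t
    joins (true  ∷ s) (true  ∷ t) = joins₁ s t
    joins (true  ∷ s) (false ∷ t) = mixed s t
    joins (false ∷ s) (true  ∷ t) = preserves₂-flip ∨-comm {g} (mixed t s)

lemma2p15 : (m n : ℕ) (f : CubeMorphism m n) →
    (PreservesMeets (fun f) × PreservesJoins (fun f)) ⇔ DimensionPreserving f
lemma2p15 m n f = mk⇔ toDimensionPreserving fromDimensionPreserving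
  where
  toDimensionPreserving : PreservesMeets (fun f) × PreservesJoins (fun f) → DimensionPreserving f
  toDimensionPreserving (meets , joins) =
    sendsSteps⇒dimensionPreserving f (lattice⇒sendsSteps f meets joins)

  fromDimensionPreserving : DimensionPreserving f → PreservesMeets (fun f) × PreservesJoins (fun f)
  fromDimensionPreserving preserving =
    sendsSteps⇒preservesMeets sends , sendsSteps⇒preservesJoins sends
    where
    sends : fun f SendsStepsVia basisDim f
    sends = dimensionPreserving⇒sendsSteps f preserving
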